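{- Let $n\ge 3$ and $d\ge 1$ be integers. Then (a) $P(n,2,d)\ge 3$ if $d\le n+\lfloor n/3\rfloor-2$; and (b) $P(n,2,d)\ge 5$ if $d\le n-2$.
   Context: For permutations $\sigma,\pi$ of $[1\ldots n]=\{1,\dots,n\}$, the Kendall-$\tau$ distance $d(\sigma,\pi)$ is the minimum number of adjacent transpositions needed to transform $\sigma$ into $\pi$. $S_{n,2}$ is the set of permutations of $[1\ldots n]$ in which the symbols $1,\dots,n-2$ appear in increasing order. An $(n,2,d)$-array is a subset of $S_{n,2}$ whose pairwise Kendall-$\tau$ distances are all at least $d$, and $P(n,2,d)$ is the maximum cardinality of an $(n,2,d)$-array. -}

module Defs where

open import Data.Nat using (ℕ; zero; suc; _≤_; _<_; _∸_)
open import Data.Fin using (Fin; toℕ)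
open import Data.Vec using (Vec; []; _∷_; lookup)
open import Data.Vec.Relation.Unary.Unique.Propositional using () renaming (Unique to VUnique)
open import Data.List using (List; length)
open import Data.List.Relation.Unary.All using (All)
open import Data.List.Relation.Unary.AllPairs using (AllPairs)
open import Data.List.Relation.Unary.Unique.Propositional using (Unique)
open import Data.Product using (Σ; _×_)

-- Symbols 1..n are represented by Fin n (symbol s+1 ↔ s : Fin n).
-- A permutation of [1..n] in one-line notation: a word of length n
-- over the n symbols with no repeated symbol.
Word : ℕ → Set
Word n = Vec (Fin n) n

IsPerm : ∀ {n} → Word n → Set
IsPerm v = VUnique v

data AdjSwap {A : Set} : ∀ {m} → Vec A m → Vec A m → Set where
  here  : ∀ {m} {x y : A} {xs : Vec A m} → AdjSwap (x ∷ y ∷ xs) (y ∷ x ∷ xs)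
  there : ∀ {m} {x : A} {xs ys : Vec A m} → AdjSwap xs ys → AdjSwap (x ∷ xs) (x ∷ ys)

data Steps {A : Set} {m : ℕ} : ℕ → Vec A m → Vec A m → Set where
  done : ∀ {u} → Steps zero u u
  step : ∀ {k u v w} → AdjSwap u v → Steps k v w → Steps (suc k) u w

KendallAtLeast : ∀ {n} → ℕ → Word n → Word n → Set
KendallAtLeast d σ π = ∀ k → k < d → Steps k σ π → ⊥'
  where open import Data.Empty renaming (⊥ to ⊥')

-- σ ∈ S_{n,2}: σ is a permutation and the symbols 1..n-2 (here 0..n-3)
-- appear in increasing order (left to right).
InS2 : ∀ {n} → Word n → Set
InS2 {n} σ = IsPerm σ ×
  (∀ (p q : Fin n) → toℕ p < toℕ q →
     toℕ (lookup σ p) < n ∸ 2 → toℕ (lookup σ q) < n ∸ 2 →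
     toℕ (lookup σ p) < toℕ (lookup σ q))

-- An (n,2,d)-array: a (finite) subset of S_{n,2}, given as a duplicate-free
-- list, with pairwise Kendall-τ distances at least d.
IsArray : (n d : ℕ) → List (Word n) → Set
IsArray n d C = Unique C × All InS2 C × AllPairs (KendallAtLeast d) C

PAtLeast : (n d k : ℕ) → Set
PAtLeast n d k = Σ (List (Word n)) λ C → IsArray n d C × k ≤ length C

module Submission where

-- A word of S_{n,2} is determined by how many of the M = n - 2 ordered symbols precede each
-- of the two free symbols X = M and Y = M + 1, and by the order of X and Y.  For any 0/1
-- relation R on symbols, the number of position pairs i < j with R (σ i) (σ j) changes by at
-- most one under an adjacent transposition, so a difference of such counts bounds the
-- Kendall-τ distance from below.  Taking R to depend only on the kinds (ordered, X, Y) of the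
-- symbols, and orienting each kind pair towards the first word, shows that words with
-- parameters (a, b) and (a′, b′) are at distance at least |a - a′| + |b - b′| + [X, Y in
-- different orders].  The arrays are then explicit: with K = ⌊n/3⌋ the words
-- (0, 0, YX), (M, K, YX), (K - 1, M, XY) for (a), and (0, 0, XY), (M, M, XY), (0, M, XY),
-- (M, 0, YX), (⌊M/2⌋, ⌊M/2⌋, YX) for (b).

open import Defs
open import Data.Bool using (Bool; true; false; not)
open import Data.Empty using (⊥-elim)
open import Data.Fin as Fin using (Fin; toℕ; fromℕ<)
open import Data.Fin.Properties using (toℕ-fromℕ<)
open import Data.Nat
open import Data.Nat.DivMod using (_/_; m/n*n≤m; m≥n⇒m/n>0)
open import Data.Nat.Properties
open import Data.Nat.Tactic.RingSolver using (solve-∀)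
open import Data.List using (List; []; _∷_)
import Data.List.Relation.Unary.All as ListAll
import Data.List.Relation.Unary.AllPairs as ListAllPairs
open ListAll using ([]; _∷_)
open ListAllPairs using ([]; _∷_)
open import Data.Product using (_×_; _,_)
open import Data.Vec using (Vec; []; _∷_; map; lookup; replicate; countᵇ)
open import Data.Vec.Properties using (map-∘)
open import Data.Vec.Relation.Unary.All using (All; []; _∷_)
import Data.Vec.Relation.Unary.All as All
import Data.Vec.Relation.Unary.All.Properties as All
open import Data.Vec.Relation.Unary.AllPairs using (AllPairs; []; _∷_)
import Data.Vec.Relation.Unary.AllPairs as AllPairs
open import Function using (_∘′_)
open import Relation.Binary.PropositionalEquality
open import Relation.Nullary.Reflects using (ofʸ; ofⁿ)
open import Algebra.Properties.CommutativeSemigroup +-commutativeSemigroup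
  using (x∙yz≈y∙xz; xy∙z≈xz∙y; xy∙z≈z∙xy; interchange)

infixl 7 _⊙_

_⊙_ : Bool → ℕ → ℕ
true  ⊙ n = n
false ⊙ n = 0

⊙-zeroʳ : ∀ b → b ⊙ 0 ≡ 0
⊙-zeroʳ true  = refl
⊙-zeroʳ false = refl

⊙-suc : ∀ b n → b ⊙ suc n ≡ b ⊙ 1 + b ⊙ n
⊙-suc true  n = refl
⊙-suc false n = refl

⊙-≤ : ∀ b n → b ⊙ n ≤ n
⊙-≤ true  n = ≤-refl
⊙-≤ false n = z≤n

module _ {A : Set} (p : A → Bool) where

  countᵇ-∷ : ∀ x {k} (xs : Vec A k) → countᵇ p (x ∷ xs) ≡ p x ⊙ 1 + countᵇ p xs
  countᵇ-∷ x xs with p x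
  ... | true  = refl
  ... | false = refl

  countᵇ-replicate : ∀ r x → countᵇ p (replicate r x) ≡ p x ⊙ r
  countᵇ-replicate zero    x = sym (⊙-zeroʳ (p x))
  countᵇ-replicate (suc r) x = begin
    countᵇ p (x ∷ replicate r x)       ≡⟨ countᵇ-∷ x (replicate r x) ⟩
    p x ⊙ 1 + countᵇ p (replicate r x) ≡⟨ cong (p x ⊙ 1 +_) (countᵇ-replicate r x) ⟩
    p x ⊙ 1 + p x ⊙ r                  ≡⟨ ⊙-suc (p x) r ⟨
    p x ⊙ suc r                        ∎
    where open ≡-Reasoning

  countᵇ-swap : ∀ {k} {u v : Vec A k} → AdjSwap u v → countᵇ p u ≡ countᵇ p v
  countᵇ-swap (here {x = x} {y} {xs}) = begin
    countᵇ p (x ∷ y ∷ xs)             ≡⟨ countᵇ-∷ x (y ∷ xs) ⟩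
    p x ⊙ 1 + countᵇ p (y ∷ xs)       ≡⟨ cong (p x ⊙ 1 +_) (countᵇ-∷ y xs) ⟩
    p x ⊙ 1 + (p y ⊙ 1 + countᵇ p xs) ≡⟨ x∙yz≈y∙xz (p x ⊙ 1) (p y ⊙ 1) (countᵇ p xs) ⟩
    p y ⊙ 1 + (p x ⊙ 1 + countᵇ p xs) ≡⟨ cong (p y ⊙ 1 +_) (countᵇ-∷ x xs) ⟨
    p y ⊙ 1 + countᵇ p (x ∷ xs)       ≡⟨ countᵇ-∷ y (x ∷ xs) ⟨
    countᵇ p (y ∷ x ∷ xs)             ∎
    where open ≡-Reasoning
  countᵇ-swap (there {x = x} {xs} {ys} s) = begin
    countᵇ p (x ∷ xs)     ≡⟨ countᵇ-∷ x xs ⟩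
    p x ⊙ 1 + countᵇ p xs ≡⟨ cong (p x ⊙ 1 +_) (countᵇ-swap s) ⟩
    p x ⊙ 1 + countᵇ p ys ≡⟨ countᵇ-∷ x ys ⟨
    countᵇ p (x ∷ ys)     ∎
    where open ≡-Reasoning

  countᵇ≡0⇒All : ∀ {k} (xs : Vec A k) → countᵇ p xs ≡ 0 → All (λ x → p x ≡ false) xs
  countᵇ≡0⇒All []       _  = []
  countᵇ≡0⇒All (x ∷ xs) eq with p x in px
  ... | false = px ∷ countᵇ≡0⇒All xs eq

countᵇ-map : ∀ {A B : Set} (p : B → Bool) (f : A → B) {k} (xs : Vec A k) →
             countᵇ p (map f xs) ≡ countᵇ (λ x → p (f x)) xs
countᵇ-map p f []       = refl
countᵇ-map p f (x ∷ xs) with p (f x)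
... | true  = cong suc (countᵇ-map p f xs)
... | false = countᵇ-map p f xs

module _ {A : Set} (R : A → A → Bool) where

  inversions : ∀ {k} → Vec A k → ℕ
  inversions []       = 0
  inversions (x ∷ xs) = countᵇ (R x) xs + inversions xs

  inversions-swap : ∀ {k} {u v : Vec A k} → AdjSwap u v → inversions u ≤ suc (inversions v)
  inversions-swap (here {x = x} {y} {xs}) = begin
    countᵇ (R x) (y ∷ xs) + (cy + i)       ≡⟨ cong (_+ (cy + i)) (countᵇ-∷ (R x) y xs) ⟩
    (R x y ⊙ 1 + cx) + (cy + i)            ≤⟨ +-monoˡ-≤ (cy + i) (+-monoˡ-≤ cx (⊙-≤ (R x y) 1)) ⟩
    suc (cx + (cy + i))                    ≡⟨ cong suc (x∙yz≈y∙xz cx cy i) ⟩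
    suc (cy + (cx + i))                    ≤⟨ s≤s (m≤n+m (cy + (cx + i)) (R y x ⊙ 1)) ⟩
    suc (R y x ⊙ 1 + (cy + (cx + i)))      ≡⟨ cong suc (+-assoc (R y x ⊙ 1) cy (cx + i)) ⟨
    suc ((R y x ⊙ 1 + cy) + (cx + i))      ≡⟨ cong (λ c → suc (c + (cx + i))) (countᵇ-∷ (R y) x xs) ⟨
    suc (countᵇ (R y) (x ∷ xs) + (cx + i)) ∎
    where
    open ≤-Reasoning
    cx = countᵇ (R x) xs
    cy = countᵇ (R y) xs
    i  = inversions xs
  inversions-swap (there {x = x} {xs} {ys} s) = begin
    countᵇ (R x) xs + inversions xs       ≤⟨ +-monoʳ-≤ (countᵇ (R x) xs) (inversions-swap s) ⟩
    countᵇ (R x) xs + suc (inversions ys) ≡⟨ +-suc (countᵇ (R x) xs) (inversions ys) ⟩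
    suc (countᵇ (R x) xs + inversions ys) ≡⟨ cong (λ c → suc (c + inversions ys)) (countᵇ-swap (R x) s) ⟩
    suc (countᵇ (R x) ys + inversions ys) ∎
    where open ≤-Reasoning

  inversions-steps : ∀ {k m} {u v : Vec A m} → Steps k u v → inversions u ≤ inversions v + k
  inversions-steps {v = v} done = m≤m+n (inversions v) 0
  inversions-steps {suc k} {u = u} {w} (step {v = v} s ss) = begin
    inversions u           ≤⟨ inversions-swap s ⟩
    suc (inversions v)     ≤⟨ s≤s (inversions-steps ss) ⟩
    suc (inversions w + k) ≡⟨ +-suc (inversions w) k ⟨
    inversions w + suc k   ∎
    where open ≤-Reasoning

inversions-map : ∀ {A B : Set} (R : B → B → Bool) (f : A → B) {k} (xs : Vec A k) →
                 inversions R (map f xs) ≡ inversions (λ x y → R (f x) (f y)) xs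
inversions-map R f []       = refl
inversions-map R f (x ∷ xs) = cong₂ _+_ (countᵇ-map (R (f x)) f xs) (inversions-map R f xs)

inversion-gap⇒KendallAtLeast : ∀ {n d} (R : Fin n → Fin n → Bool) {σ π : Word n} →
                               inversions R π + d ≤ inversions R σ → KendallAtLeast d σ π
inversion-gap⇒KendallAtLeast {d = d} R {σ} {π} gap k k<d steps = <-irrefl refl (begin-strict
  inversions R π + k <⟨ +-monoʳ-< (inversions R π) k<d ⟩
  inversions R π + d ≤⟨ gap ⟩
  inversions R σ     ≤⟨ inversions-steps R steps ⟩
  inversions R π + k ∎)
  where open ≤-Reasoning

data Kind : Set where
  S X Y : Kind

_==_ : Kind → Kind → Bool
S == S = true
X == X = true
Y == Y = true
_ == _ = false

count : ∀ {k} → Kind → Vec Kind k → ℕ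
count c = countᵇ (c ==_)

place₁ : Kind → ℕ → (r : ℕ) → Vec Kind (suc r)
place₁ z zero    r       = z ∷ replicate r S
place₁ z (suc b) zero    = z ∷ []
place₁ z (suc b) (suc r) = S ∷ place₁ z b r

-- X after the first a and Y after the first b of r ordered symbols (a, b ≤ r); when a ≡ b,
-- o tells whether X comes first.
place₂ : ℕ → ℕ → Bool → (r : ℕ) → Vec Kind (2 + r)
place₂ zero    zero    true  r       = X ∷ place₁ Y zero r
place₂ zero    zero    false r       = Y ∷ place₁ X zero r
place₂ zero    (suc b) o     r       = X ∷ place₁ Y (suc b) r
place₂ (suc a) zero    o     r       = Y ∷ place₁ X (suc a) r
place₂ (suc a) (suc b) o     zero    = X ∷ place₁ Y zero zero
place₂ (suc a) (suc b) o     (suc r) = S ∷ place₂ a b o r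

xBeforeY : ℕ → ℕ → Bool → ℕ
xBeforeY zero    zero    o = o ⊙ 1
xBeforeY zero    (suc b) o = 1
xBeforeY (suc a) zero    o = 0
xBeforeY (suc a) (suc b) o = xBeforeY a b o

xBeforeY-≤ : ∀ {a b} → a ≤ b → xBeforeY a b true ≡ 1
xBeforeY-≤ {zero}  {zero}  _         = refl
xBeforeY-≤ {zero}  {suc b} _         = refl
xBeforeY-≤ {suc a} {suc b} (s≤s a≤b) = xBeforeY-≤ a≤b

xBeforeY-≥ : ∀ {a b} → b ≤ a → xBeforeY a b false ≡ 0
xBeforeY-≥ {zero}  {zero}  _         = refl
xBeforeY-≥ {suc a} {zero}  _         = refl
xBeforeY-≥ {suc a} {suc b} (s≤s b≤a) = xBeforeY-≥ b≤a

xBeforeY≤1 : ∀ a b o → xBeforeY a b o ≤ 1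
xBeforeY≤1 zero    zero    o = ⊙-≤ o 1
xBeforeY≤1 zero    (suc b) o = ≤-refl
xBeforeY≤1 (suc a) zero    o = z≤n
xBeforeY≤1 (suc a) (suc b) o = xBeforeY≤1 a b o

module _ (p : Kind → Bool) where

  countᵇ-place₁ : ∀ z b r → countᵇ p (place₁ z b r) ≡ p S ⊙ r + p z ⊙ 1
  countᵇ-place₁ z zero r
    rewrite countᵇ-∷ p z (replicate r S) | countᵇ-replicate p r S = +-comm (p z ⊙ 1) (p S ⊙ r)
  countᵇ-place₁ z (suc b) zero
    rewrite countᵇ-∷ p z [] | ⊙-zeroʳ (p S) = +-identityʳ (p z ⊙ 1)
  countᵇ-place₁ z (suc b) (suc r)
    rewrite countᵇ-∷ p S (place₁ z b r) | countᵇ-place₁ z b r | ⊙-suc (p S) r =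
    sym (+-assoc (p S ⊙ 1) (p S ⊙ r) (p z ⊙ 1))

  countᵇ-∷place₁ : ∀ c z b r → countᵇ p (c ∷ place₁ z b r) ≡ p S ⊙ r + (p c ⊙ 1 + p z ⊙ 1)
  countᵇ-∷place₁ c z b r
    rewrite countᵇ-∷ p c (place₁ z b r) | countᵇ-place₁ z b r = x∙yz≈y∙xz (p c ⊙ 1) (p S ⊙ r) (p z ⊙ 1)

  countᵇ-place₂ : ∀ a b o r → countᵇ p (place₂ a b o r) ≡ p S ⊙ r + (p X ⊙ 1 + p Y ⊙ 1)
  countᵇ-place₂ zero    zero    true  r       = countᵇ-∷place₁ X Y zero r
  countᵇ-place₂ zero    zero    false r       =
    trans (countᵇ-∷place₁ Y X zero r) (cong (p S ⊙ r +_) (+-comm (p Y ⊙ 1) (p X ⊙ 1)))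
  countᵇ-place₂ zero    (suc b) o     r       = countᵇ-∷place₁ X Y (suc b) r
  countᵇ-place₂ (suc a) zero    o     r       =
    trans (countᵇ-∷place₁ Y X (suc a) r) (cong (p S ⊙ r +_) (+-comm (p Y ⊙ 1) (p X ⊙ 1)))
  countᵇ-place₂ (suc a) (suc b) o     zero    = countᵇ-∷place₁ X Y zero zero
  countᵇ-place₂ (suc a) (suc b) o     (suc r)
    rewrite countᵇ-∷ p S (place₂ a b o r) | countᵇ-place₂ a b o r | ⊙-suc (p S) r =
    sym (+-assoc (p S ⊙ 1) (p S ⊙ r) (p X ⊙ 1 + p Y ⊙ 1))

-- The weighted pairs between one free symbol and r ordered symbols, a of them before it:
-- each earlier one counts u, each later one counts v.
weigh : Bool → Bool → ℕ → ℕ → ℕ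
weigh u v a r = u ⊙ a + v ⊙ (r ∸ a)

weigh-zero : ∀ u v r → weigh u v 0 r ≡ v ⊙ r
weigh-zero u v r = cong (_+ v ⊙ r) (⊙-zeroʳ u)

weigh-one : ∀ u v → weigh u v 1 1 ≡ u ⊙ 1
weigh-one u v = trans (cong (u ⊙ 1 +_) (⊙-zeroʳ v)) (+-identityʳ (u ⊙ 1))

weigh-suc : ∀ u v a r → weigh u v (suc a) (suc r) ≡ u ⊙ 1 + weigh u v a r
weigh-suc u v a r = trans (cong (_+ v ⊙ (r ∸ a)) (⊙-suc u a)) (+-assoc (u ⊙ 1) (u ⊙ a) (v ⊙ (r ∸ a)))

module _ (B : Kind → Kind → Bool) (B-SS : B S S ≡ false) where

  inversions-replicate : ∀ r → inversions B (replicate r S) ≡ 0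
  inversions-replicate zero = refl
  inversions-replicate (suc r)
    rewrite countᵇ-replicate (B S) r S | B-SS = inversions-replicate r

  inversions-place₁ : ∀ z {b r} → b ≤ r → inversions B (place₁ z b r) ≡ weigh (B S z) (B z S) b r
  inversions-place₁ z {zero} {r} _
    rewrite countᵇ-replicate (B z) r S | inversions-replicate r | weigh-zero (B S z) (B z S) r =
    +-identityʳ (B z S ⊙ r)
  inversions-place₁ z {suc b} {suc r} (s≤s b≤r)
    rewrite countᵇ-place₁ (B S) z b r | B-SS | inversions-place₁ z b≤r =
    sym (weigh-suc (B S z) (B z S) b r)

  inversions-X∷place₁ : ∀ {b r} → b ≤ r → inversions B (X ∷ place₁ Y b r) ≡
    weigh (B S X) (B X S) 0 r + weigh (B S Y) (B Y S) b r + weigh (B X Y) (B Y X) 1 1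
  inversions-X∷place₁ {b} {r} b≤r
    rewrite countᵇ-place₁ (B X) Y b r | inversions-place₁ Y b≤r
          | weigh-zero (B S X) (B X S) r | weigh-one (B X Y) (B Y X) =
    xy∙z≈xz∙y (B X S ⊙ r) (B X Y ⊙ 1) (weigh (B S Y) (B Y S) b r)

  inversions-Y∷place₁ : ∀ {a r} → a ≤ r → inversions B (Y ∷ place₁ X a r) ≡
    weigh (B S X) (B X S) a r + weigh (B S Y) (B Y S) 0 r + weigh (B X Y) (B Y X) 0 1
  inversions-Y∷place₁ {a} {r} a≤r
    rewrite countᵇ-place₁ (B Y) X a r | inversions-place₁ X a≤r
          | weigh-zero (B S Y) (B Y S) r | weigh-zero (B X Y) (B Y X) 1 =
    trans (xy∙z≈z∙xy (B Y S ⊙ r) (B Y X ⊙ 1) (weigh (B S X) (B X S) a r))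
      (sym (+-assoc (weigh (B S X) (B X S) a r) (B Y S ⊙ r) (B Y X ⊙ 1)))

  inversions-place₂ : ∀ {a b} o {r} → a ≤ r → b ≤ r →
    inversions B (place₂ a b o r) ≡
      weigh (B S X) (B X S) a r + weigh (B S Y) (B Y S) b r + weigh (B X Y) (B Y X) (xBeforeY a b o) 1
  inversions-place₂ {zero}  {zero}  true  _         _         = inversions-X∷place₁ z≤n
  inversions-place₂ {zero}  {zero}  false _         _         = inversions-Y∷place₁ z≤n
  inversions-place₂ {zero}  {suc b} o     _         b≤r       = inversions-X∷place₁ b≤r
  inversions-place₂ {suc a} {zero}  o     a≤r       _         = inversions-Y∷place₁ a≤r
  inversions-place₂ {suc a} {suc b} o {suc r} (s≤s a≤r) (s≤s b≤r)
    rewrite countᵇ-place₂ (B S) a b o r | B-SS | inversions-place₂ o a≤r b≤r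
          | weigh-suc (B S X) (B X S) a r | weigh-suc (B S Y) (B Y S) b r =
    trans (sym (+-assoc (B S X ⊙ 1 + B S Y ⊙ 1) (weigh (B S X) (B X S) a r + weigh (B S Y) (B Y S) b r) _))
      (cong (_+ weigh (B X Y) (B Y X) (xBeforeY a b o) 1)
        (interchange (B S X ⊙ 1) (B S Y ⊙ 1) (weigh (B S X) (B X S) a r) (weigh (B S Y) (B Y S) b r)))

-- kind M z: the symbols below M are ordered, M is X and M + 1 is Y.
kind : ℕ → ℕ → Kind
kind zero    zero    = X
kind zero    (suc _) = Y
kind (suc M) zero    = S
kind (suc M) (suc z) = kind M z

kind-< : ∀ {M z} → z < M → kind M z ≡ S
kind-< {suc M} {zero}  _         = refl
kind-< {suc M} {suc z} (s≤s z<M) = kind-< z<M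

kind-X : ∀ M → kind M M ≡ X
kind-X zero    = refl
kind-X (suc M) = kind-X M

kind-Y : ∀ M → kind M (suc M) ≡ Y
kind-Y zero    = refl
kind-Y (suc M) = kind-Y M

label : ∀ {k} → ℕ → ℕ → Vec Kind k → Vec ℕ k
label M s []      = []
label M s (S ∷ w) = s ∷ label M (suc s) w
label M s (X ∷ w) = M ∷ label M s w
label M s (Y ∷ w) = suc M ∷ label M s w

module _ (M : ℕ) where

  private
    next-small : ∀ {s c} → s + suc c ≤ M → suc s + c ≤ M
    next-small {s} {c} = subst (_≤ M) (+-suc s c)

    small<M : ∀ {s c} → s + suc c ≤ M → s < M
    small<M {s} {c} h = ≤-trans (s≤s (m≤m+n s c)) (next-small h)

  kind-label : ∀ {k} s (w : Vec Kind k) → s + count S w ≤ M → map (kind M) (label M s w) ≡ w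
  kind-label s []      _ = refl
  kind-label s (S ∷ w) h = cong₂ _∷_ (kind-< (small<M h)) (kind-label (suc s) w (next-small h))
  kind-label s (X ∷ w) h = cong₂ _∷_ (kind-X M) (kind-label s w h)
  kind-label s (Y ∷ w) h = cong₂ _∷_ (kind-Y M) (kind-label s w h)

  label-< : ∀ {k} s (w : Vec Kind k) → s + count S w ≤ M → All (_< 2 + M) (label M s w)
  label-< s []      _ = []
  label-< s (S ∷ w) h = <-≤-trans (small<M h) (m≤n+m M 2) ∷ label-< (suc s) w (next-small h)
  label-< s (X ∷ w) h = s≤s (n≤1+n M) ∷ label-< s w h
  label-< s (Y ∷ w) h = ≤-refl ∷ label-< s w h

  label-≥ : ∀ {k} s (w : Vec Kind k) → All (λ z → z < M → s ≤ z) (label M s w)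
  label-≥ s []      = []
  label-≥ s (S ∷ w) = (λ _ → ≤-refl) ∷ All.map (λ h z<M → <⇒≤ (h z<M)) (label-≥ (suc s) w)
  label-≥ s (X ∷ w) = (λ M<M → ⊥-elim (n≮n M M<M)) ∷ label-≥ s w
  label-≥ s (Y ∷ w) = (λ 1+M<M → ⊥-elim (1+n≰n (<⇒≤ 1+M<M))) ∷ label-≥ s w

  label-sorted : ∀ {k} s (w : Vec Kind k) → AllPairs (λ x y → x < M → y < M → x < y) (label M s w)
  label-sorted s []      = []
  label-sorted s (S ∷ w) = All.map (λ h _ z<M → h z<M) (label-≥ (suc s) w) ∷ label-sorted (suc s) w
  label-sorted s (X ∷ w) =
    All.universal (λ _ M<M _ → ⊥-elim (n≮n M M<M)) (label M s w) ∷ label-sorted s w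
  label-sorted s (Y ∷ w) =
    All.universal (λ _ 1+M<M _ → ⊥-elim (1+n≰n (<⇒≤ 1+M<M))) (label M s w) ∷ label-sorted s w

  label-avoids : ∀ {k c z} s (w : Vec Kind k) → s + count S w ≤ M → count c w ≡ 0 → kind M z ≡ c →
                 All (z ≢_) (label M s w)
  label-avoids {c = c} s w h absent refl =
    All.map (λ { c≠ refl → true≢false (trans (sym (==-refl c)) c≠) })
      (All.map⁻ (subst (All (λ c′ → (c == c′) ≡ false)) (sym (kind-label s w h)) (countᵇ≡0⇒All (c ==_) w absent)))
    where
    ==-refl : ∀ c → (c == c) ≡ true
    ==-refl S = refl
    ==-refl X = refl
    ==-refl Y = refl
    true≢false : true ≢ false
    true≢false ()

  label-unique : ∀ {k} s (w : Vec Kind k) → s + count S w ≤ M → count X w ≤ 1 → count Y w ≤ 1 →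
                 AllPairs _≢_ (label M s w)
  label-unique s []      _ _ _ = []
  label-unique s (S ∷ w) h x y =
    All.map (λ { s<z refl → n≮n s (s<z (small<M h)) }) (label-≥ (suc s) w)
    ∷ label-unique (suc s) w (next-small h) x y
  label-unique s (X ∷ w) h x y =
    label-avoids s w h (n≤0⇒n≡0 (s≤s⁻¹ x)) (kind-X M) ∷ label-unique s w h (≤-trans (n≤1+n _) x) y
  label-unique s (Y ∷ w) h x y =
    label-avoids s w h (n≤0⇒n≡0 (s≤s⁻¹ y)) (kind-Y M) ∷ label-unique s w h x (≤-trans (n≤1+n _) y)

AllPairs-map⁻ : ∀ {A B : Set} {R : B → B → Set} {f : A → B} {k} {xs : Vec A k} →
                AllPairs R (map f xs) → AllPairs (λ x y → R (f x) (f y)) xs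
AllPairs-map⁻ {xs = []}     []      = []
AllPairs-map⁻ {xs = x ∷ xs} (h ∷ t) = All.map⁻ h ∷ AllPairs-map⁻ t

AllPairs-lookup : ∀ {A : Set} {R : A → A → Set} {k} {xs : Vec A k} → AllPairs R xs →
                  ∀ {i j : Fin k} → toℕ i < toℕ j → R (lookup xs i) (lookup xs j)
AllPairs-lookup (h ∷ t) {Fin.zero}  {Fin.suc j} _         = All.lookup⁺ h j
AllPairs-lookup (h ∷ t) {Fin.suc i} {Fin.suc j} (s≤s i<j) = AllPairs-lookup t i<j

map-toℕ-reduce-fromℕ< : ∀ {n k} {xs : Vec ℕ k} (xs<n : All (_< n) xs) →
                        map toℕ (All.reduce (λ x<n → fromℕ< x<n) xs<n) ≡ xs
map-toℕ-reduce-fromℕ< []           = refl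
map-toℕ-reduce-fromℕ< (x<n ∷ xs<n) = cong₂ _∷_ (toℕ-fromℕ< x<n) (map-toℕ-reduce-fromℕ< xs<n)

∸-telescope : ∀ {a b c} → a ≤ b → b ≤ c → (c ∸ b) + (b ∸ a) ≡ c ∸ a
∸-telescope z≤n       b≤c       = m∸n+n≡m b≤c
∸-telescope (s≤s a≤b) (s≤s b≤c) = ∸-telescope a≤b b≤c

weigh-gap : ∀ {a a′ r} → a ≤ r → a′ ≤ r →
            let p = a′ ≤ᵇ a in weigh p (not p) a′ r + ∣ a - a′ ∣ ≡ weigh p (not p) a r
weigh-gap {a} {a′} {r} a≤r a′≤r with a′ ≤ᵇ a | ≤ᵇ-reflects-≤ a′ a
... | true  | ofʸ a′≤a
  rewrite +-identityʳ a′ | +-identityʳ a | m≤n⇒∣n-m∣≡n∸m a′≤a = m+[n∸m]≡n a′≤a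
... | false | ofⁿ a′≰a
  rewrite m≤n⇒∣m-n∣≡n∸m (<⇒≤ (≰⇒> a′≰a)) = ∸-telescope (<⇒≤ (≰⇒> a′≰a)) a′≤r

towards : Bool → Bool → Bool → Kind → Kind → Bool
towards p q s S X = p
towards p q s X S = not p
towards p q s S Y = q
towards p q s Y S = not q
towards p q s X Y = s
towards p q s Y X = not s
towards p q s _ _ = false

module Words (M : ℕ) where

  private
    count-S-place₂ : ∀ a b o → 0 + count S (place₂ a b o M) ≤ M
    count-S-place₂ a b o = ≤-reflexive (trans (countᵇ-place₂ (S ==_) a b o M) (+-identityʳ M))

  opaque
    word : ℕ → ℕ → Bool → Word (2 + M)
    word a b o = All.reduce (λ x<n → fromℕ< x<n) (label-< M 0 (place₂ a b o M) (count-S-place₂ a b o))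

    toℕ-word : ∀ a b o → map toℕ (word a b o) ≡ label M 0 (place₂ a b o M)
    toℕ-word a b o = map-toℕ-reduce-fromℕ< (label-< M 0 (place₂ a b o M) (count-S-place₂ a b o))

  word-InS2 : ∀ a b o → InS2 (word a b o)
  word-InS2 a b o = unique , sorted
    where
    onLabels : ∀ {R : ℕ → ℕ → Set} → AllPairs R (label M 0 (place₂ a b o M)) →
               AllPairs (λ x y → R (toℕ x) (toℕ y)) (word a b o)
    onLabels = AllPairs-map⁻ ∘′ subst (AllPairs _) (sym (toℕ-word a b o))
    unique : IsPerm (word a b o)
    unique = AllPairs.map (λ toℕ≢ x≡y → toℕ≢ (cong toℕ x≡y))
      (onLabels (label-unique M 0 (place₂ a b o M) (count-S-place₂ a b o)
        (≤-reflexive (countᵇ-place₂ (X ==_) a b o M)) (≤-reflexive (countᵇ-place₂ (Y ==_) a b o M))))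
    sorted : ∀ (p q : Fin (2 + M)) → toℕ p < toℕ q →
             toℕ (lookup (word a b o) p) < M → toℕ (lookup (word a b o) q) < M →
             toℕ (lookup (word a b o) p) < toℕ (lookup (word a b o) q)
    sorted p q = AllPairs-lookup (onLabels (label-sorted M 0 (place₂ a b o M)))

  inversions-word : ∀ (B : Kind → Kind → Bool) a b o →
    inversions (λ x y → B (kind M (toℕ x)) (kind M (toℕ y))) (word a b o) ≡ inversions B (place₂ a b o M)
  inversions-word B a b o = begin
    inversions (λ x y → B (kind M (toℕ x)) (kind M (toℕ y))) (word a b o)
      ≡⟨ inversions-map B (λ x → kind M (toℕ x)) (word a b o) ⟨
    inversions B (map (λ x → kind M (toℕ x)) (word a b o))
      ≡⟨ cong (inversions B) (map-∘ (kind M) toℕ (word a b o)) ⟩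
    inversions B (map (kind M) (map toℕ (word a b o)))
      ≡⟨ cong (λ v → inversions B (map (kind M) v)) (toℕ-word a b o) ⟩
    inversions B (map (kind M) (label M 0 (place₂ a b o M)))
      ≡⟨ cong (inversions B) (kind-label M 0 (place₂ a b o M) (count-S-place₂ a b o)) ⟩
    inversions B (place₂ a b o M) ∎
    where open ≡-Reasoning

  -- The relation `towards p q s` orients each of the kind pairs (S, X), (S, Y), (X, Y) so that
  -- the first word has the larger count; its inversion counts then differ by exactly the bound.
  word-far : ∀ {a b o a′ b′ o′ d} → a ≤ M → b ≤ M → a′ ≤ M → b′ ≤ M →
    d ≤ ∣ a - a′ ∣ + ∣ b - b′ ∣ + ∣ xBeforeY a b o - xBeforeY a′ b′ o′ ∣ →
    KendallAtLeast d (word a b o) (word a′ b′ o′)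
  word-far {a} {b} {o} {a′} {b′} {o′} {d} a≤M b≤M a′≤M b′≤M d≤Δ =
    inversion-gap⇒KendallAtLeast onKinds (begin
      inversions onKinds (word a′ b′ o′) + d              ≤⟨ +-monoʳ-≤ _ d≤Δ ⟩
      inversions onKinds (word a′ b′ o′) + (Δa + Δb + Δe) ≡⟨ cong (_+ (Δa + Δb + Δe)) (formula o′ a′≤M b′≤M) ⟩
      (wa′ + wb′ + we′) + (Δa + Δb + Δe)                  ≡⟨ interchange (wa′ + wb′) we′ (Δa + Δb) Δe ⟩
      (wa′ + wb′) + (Δa + Δb) + (we′ + Δe)                ≡⟨ cong (_+ (we′ + Δe)) (interchange wa′ wb′ Δa Δb) ⟩
      (wa′ + Δa) + (wb′ + Δb) + (we′ + Δe)                ≡⟨ cong₂ _+_ (cong₂ _+_ gap-a gap-b) gap-e ⟩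
      wa + wb + we                                        ≡⟨ formula o a≤M b≤M ⟨
      inversions onKinds (word a b o)                     ∎)
    where
    open ≤-Reasoning
    e e′ : ℕ
    e  = xBeforeY a b o
    e′ = xBeforeY a′ b′ o′
    p q s : Bool
    p = a′ ≤ᵇ a
    q = b′ ≤ᵇ b
    s = e′ ≤ᵇ e
    onKinds : Fin (2 + M) → Fin (2 + M) → Bool
    onKinds x y = towards p q s (kind M (toℕ x)) (kind M (toℕ y))
    formula : ∀ {x y} z → x ≤ M → y ≤ M → inversions onKinds (word x y z) ≡
              weigh p (not p) x M + weigh q (not q) y M + weigh s (not s) (xBeforeY x y z) 1
    formula {x} {y} z x≤M y≤M =
      trans (inversions-word (towards p q s) x y z) (inversions-place₂ (towards p q s) refl z x≤M y≤M)
    wa wb we wa′ wb′ we′ Δa Δb Δe : ℕ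
    wa  = weigh p (not p) a M
    wb  = weigh q (not q) b M
    we  = weigh s (not s) e 1
    wa′ = weigh p (not p) a′ M
    wb′ = weigh q (not q) b′ M
    we′ = weigh s (not s) e′ 1
    Δa  = ∣ a - a′ ∣
    Δb  = ∣ b - b′ ∣
    Δe  = ∣ e - e′ ∣
    gap-a : wa′ + Δa ≡ wa
    gap-a = weigh-gap a≤M a′≤M
    gap-b : wb′ + Δb ≡ wb
    gap-b = weigh-gap b≤M b′≤M
    gap-e : we′ + Δe ≡ we
    gap-e = weigh-gap (xBeforeY≤1 a b o) (xBeforeY≤1 a′ b′ o′)

KendallAtLeast⇒≢ : ∀ {n d} {σ π : Word n} → 1 ≤ d → KendallAtLeast d σ π → σ ≢ π
KendallAtLeast⇒≢ 1≤d far refl = far 0 1≤d done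

separated⇒IsArray : ∀ {n d} {C : List (Word n)} → 1 ≤ d →
                    ListAll.All InS2 C → ListAllPairs.AllPairs (KendallAtLeast d) C → IsArray n d C
separated⇒IsArray 1≤d inS2 far = ListAllPairs.map (KendallAtLeast⇒≢ 1≤d) far , inS2 , far

module _ {d z : ℕ} (x y : ℕ) where

  ≤-first : d ≤ x → d ≤ x + y + z
  ≤-first d≤x = ≤-trans d≤x (≤-trans (m≤m+n x y) (m≤m+n (x + y) z))

  ≤-second : d ≤ y → d ≤ x + y + z
  ≤-second d≤y = ≤-trans d≤y (≤-trans (m≤n+m y x) (m≤m+n (x + y) z))

  ≤-firstTwo : d ≤ x + y → d ≤ x + y + z
  ≤-firstTwo d≤x+y = ≤-trans d≤x+y (m≤m+n (x + y) z)

PAtLeast-5 : ∀ {M d} → 1 ≤ d → d ≤ M → PAtLeast (2 + M) d 5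
PAtLeast-5 {M} {d} 1≤d d≤M =
  (A ∷ B ∷ C ∷ D ∷ E ∷ []) ,
  separated⇒IsArray 1≤d
    (word-InS2 0 0 true ∷ word-InS2 M M true ∷ word-InS2 0 M true ∷ word-InS2 M 0 false ∷ word-InS2 h h false ∷ [])
    ((A-B ∷ A-C ∷ A-D ∷ A-E ∷ []) ∷ (B-C ∷ B-D ∷ B-E ∷ []) ∷ (C-D ∷ C-E ∷ []) ∷ (D-E ∷ []) ∷ [] ∷ []) ,
  ≤-refl
  where
  open Words M
  h c : ℕ
  h = ⌊ M /2⌋
  c = ⌈ M /2⌉
  A B C D E : Word (2 + M)
  A = word 0 0 true
  B = word M M true
  C = word 0 M true
  D = word M 0 false
  E = word h h false

  h≤M : h ≤ M
  h≤M = ⌊n/2⌋≤n M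
  h+c≡M : h + c ≡ M
  h+c≡M = ⌊n/2⌋+⌈n/2⌉≡n M
  ∣M-h∣≡c : ∣ M - h ∣ ≡ c
  ∣M-h∣≡c = trans (cong (∣_- h ∣) (sym h+c≡M)) (trans (∣-∣-comm (h + c) h) (∣m-m+n∣≡n h c))
  d≤∣M-0∣ : d ≤ ∣ M - 0 ∣
  d≤∣M-0∣ = ≤-trans d≤M (≤-reflexive (sym (∣-∣-identityʳ M)))
  d≤h+c : d ≤ h + c
  d≤h+c = ≤-trans d≤M (≤-reflexive (sym h+c≡M))

  A-B : KendallAtLeast d A B
  A-B = word-far z≤n z≤n ≤-refl ≤-refl (≤-first M M d≤M)
  A-C : KendallAtLeast d A C
  A-C = word-far z≤n z≤n z≤n ≤-refl (≤-second 0 M d≤M)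
  A-D : KendallAtLeast d A D
  A-D = word-far z≤n z≤n ≤-refl z≤n (≤-first M 0 d≤M)
  A-E : KendallAtLeast d A E
  A-E = word-far z≤n z≤n h≤M h≤M
    (subst (λ e → d ≤ h + h + ∣ 1 - e ∣) (sym (xBeforeY-≥ (≤-refl {h}))) (begin
      d           ≤⟨ d≤h+c ⟩
      h + c       ≤⟨ +-monoʳ-≤ h (⌊n/2⌋-mono (n≤1+n (suc M))) ⟩
      h + suc h   ≡⟨ +-suc h h ⟩
      suc (h + h) ≡⟨ +-comm 1 (h + h) ⟩
      h + h + 1   ∎))
    where open ≤-Reasoning
  B-C : KendallAtLeast d B C
  B-C = word-far ≤-refl ≤-refl z≤n ≤-refl (≤-first ∣ M - 0 ∣ ∣ M - M ∣ d≤∣M-0∣)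
  B-D : KendallAtLeast d B D
  B-D = word-far ≤-refl ≤-refl ≤-refl z≤n (≤-second ∣ M - M ∣ ∣ M - 0 ∣ d≤∣M-0∣)
  B-E : KendallAtLeast d B E
  B-E = word-far ≤-refl ≤-refl h≤M h≤M
    (≤-firstTwo ∣ M - h ∣ ∣ M - h ∣ (subst (λ x → d ≤ x + x) (sym ∣M-h∣≡c)
      (≤-trans d≤h+c (+-monoˡ-≤ c (⌊n/2⌋≤⌈n/2⌉ M)))))
  C-D : KendallAtLeast d C D
  C-D = word-far z≤n ≤-refl ≤-refl z≤n (≤-first M ∣ M - 0 ∣ d≤M)
  C-E : KendallAtLeast d C E
  C-E = word-far z≤n ≤-refl h≤M h≤M (≤-firstTwo h ∣ M - h ∣ (subst (λ x → d ≤ h + x) (sym ∣M-h∣≡c) d≤h+c))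
  D-E : KendallAtLeast d D E
  D-E = word-far ≤-refl z≤n h≤M h≤M
    (≤-firstTwo ∣ M - h ∣ h (subst (λ x → d ≤ x + h) (sym ∣M-h∣≡c) (≤-trans d≤h+c (≤-reflexive (+-comm h c)))))

thirds-gap : ∀ {M t} → t * 3 < M → M + suc t ≤ ∣ M - t ∣ + ∣ suc t - M ∣ + 1
thirds-gap {M} {t} t*3<M with m≤n⇒∃[o]m+o≡n (≤-trans (s≤s (m≤m*n t 3)) t*3<M)
... | v , refl = begin
  suc (t + v) + suc t                         ≡⟨ shuffleˡ t v ⟩
  2 + (t + t + v)                             ≤⟨ +-monoʳ-≤ 2 (+-monoˡ-≤ v t+t≤v) ⟩
  2 + (v + v)                                 ≡⟨ shuffleʳ v ⟩
  suc v + v + 1                               ≡⟨ cong₂ (λ x y → x + y + 1) ∣M-t∣≡1+v (∣m-m+n∣≡n t v) ⟨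
  ∣ suc (t + v) - t ∣ + ∣ suc t - suc (t + v) ∣ + 1 ∎
  where
  open ≤-Reasoning
  shuffleˡ : ∀ t v → suc (t + v) + suc t ≡ 2 + (t + t + v)
  shuffleˡ = solve-∀
  shuffleʳ : ∀ v → 2 + (v + v) ≡ suc v + v + 1
  shuffleʳ = solve-∀
  threefold : ∀ t → t + (t + t) ≡ t * 3
  threefold = solve-∀
  t+t≤v : t + t ≤ v
  t+t≤v = +-cancelˡ-≤ t (t + t) v (begin
    t + (t + t) ≡⟨ threefold t ⟩
    t * 3       ≤⟨ s≤s⁻¹ t*3<M ⟩
    t + v       ∎)
  ∣M-t∣≡1+v : ∣ suc (t + v) - t ∣ ≡ suc v
  ∣M-t∣≡1+v = trans (cong (∣_- t ∣) (sym (+-suc t v))) (trans (∣-∣-comm (t + suc v) t) (∣m-m+n∣≡n t (suc v)))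

PAtLeast-3 : ∀ {M t d} → 1 ≤ d → t * 3 < M → d ≤ M + suc t → PAtLeast (2 + M) d 3
PAtLeast-3 {M} {t} {d} 1≤d t*3<M d≤M+1+t =
  (P ∷ Q ∷ R ∷ []) ,
  separated⇒IsArray 1≤d
    (word-InS2 0 0 false ∷ word-InS2 M (suc t) false ∷ word-InS2 t M true ∷ [])
    ((P-Q ∷ P-R ∷ []) ∷ (Q-R ∷ []) ∷ [] ∷ []) ,
  ≤-refl
  where
  open Words M
  P Q R : Word (2 + M)
  P = word 0 0 false
  Q = word M (suc t) false
  R = word t M true

  1+t≤M : suc t ≤ M
  1+t≤M = ≤-trans (s≤s (m≤m*n t 3)) t*3<M
  t≤M : t ≤ M
  t≤M = ≤-trans (n≤1+n t) 1+t≤M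
  R-bit : xBeforeY t M true ≡ 1
  R-bit = xBeforeY-≤ t≤M

  P-Q : KendallAtLeast d P Q
  P-Q = word-far z≤n z≤n ≤-refl 1+t≤M (≤-firstTwo M (suc t) d≤M+1+t)
  P-R : KendallAtLeast d P R
  P-R = word-far z≤n z≤n t≤M ≤-refl
    (subst (λ e → d ≤ t + M + ∣ 0 - e ∣) (sym R-bit)
      (≤-trans d≤M+1+t (≤-reflexive (trans (+-suc M t) (trans (cong suc (+-comm M t)) (+-comm 1 (t + M)))))))
  Q-R : KendallAtLeast d Q R
  Q-R = word-far ≤-refl 1+t≤M t≤M ≤-refl
    (subst₂ (λ e e′ → d ≤ ∣ M - t ∣ + ∣ suc t - M ∣ + ∣ e - e′ ∣) (sym (xBeforeY-≥ 1+t≤M)) (sym R-bit)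
      (≤-trans d≤M+1+t (thirds-gap t*3<M)))

theorem8 : (n d : ℕ) → 3 ≤ n → 1 ≤ d →
    ((d ≤ (n + n / 3) ∸ 2 → PAtLeast n d 3) ×
     (d ≤ n ∸ 2 → PAtLeast n d 5))
theorem8 (suc zero)       d (s≤s ())       _
theorem8 (suc (suc zero)) d (s≤s (s≤s ())) _
theorem8 (suc (suc (suc j))) d _ 1≤d =
  partA (n / 3) (m≥n⇒m/n>0 {n} {3} (s≤s (s≤s (s≤s z≤n)))) (m/n*n≤m n 3) , PAtLeast-5 1≤d
  where
  n : ℕ
  n = 3 + j
  partA : ∀ k → 0 < k → k * 3 ≤ n → d ≤ suc j + k → PAtLeast n d 3
  partA (suc t) _ (s≤s (s≤s (s≤s t*3≤j))) = PAtLeast-3 1≤d (s≤s t*3≤j)
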